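{- For all $n\ge1$ and all $0\le k\le n$, $P_{0,k,2n+1}=P_{0,n-k,2n+1}$ and $P_{1,k,2n+1}=P_{1,n-k-1,2n+1}$ (where coefficients with negative index $k$ are $0$).
   Context: $\mathcal{S}_m$ denotes the set of permutations $\sigma=\sigma_1\cdots\sigma_m$ of $\{1,\dots,m\}$. $\overrightarrow{des}_E(\sigma)$ is the number of indices $i\in\{1,\dots,m-1\}$ with $\sigma_i>\sigma_{i+1}$ and $\sigma_{i+1}$ even. For $j\in\{0,1\}$, $P_{j,k,m}$ is the number of $\sigma\in\mathcal{S}_m$ with $\overrightarrow{des}_E(\sigma)=k$ such that $\sigma_1$ is even if $j=1$ and $\sigma_1$ is odd if $j=0$. -}

module Defs where

open import Data.Nat using (ℕ; zero; suc; _<ᵇ_; _%_; _≡ᵇ_)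
open import Data.Bool using (Bool; true; false; _∧_; if_then_else_)
open import Data.List using (List; []; _∷_; concatMap; map; filter; length)
open import Data.Fin using (Fin)
import Data.Fin as F
open import Data.Integer using (ℤ; +_; -[1+_])
open import Data.Bool using (T?)

insertions : ℕ → List ℕ → List (List ℕ)
insertions x []       = (x ∷ []) ∷ []
insertions x (y ∷ ys) = (x ∷ y ∷ ys) ∷ map (y ∷_) (insertions x ys)

perms : ℕ → List (List ℕ)
perms zero    = [] ∷ []
perms (suc m) = concatMap (insertions (suc m)) (perms m)

isEven : ℕ → Bool
isEven n = (n % 2) ≡ᵇ 0

desE : List ℕ → ℕ
desE (a ∷ b ∷ rest) =
  (if (b <ᵇ a) ∧ isEven b then suc (desE (b ∷ rest)) else desE (b ∷ rest))
desE _ = 0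

firstOK : Fin 2 → List ℕ → Bool
firstOK j []      = false
firstOK F.zero    (a ∷ _) = Data.Bool.not (isEven a)
firstOK (F.suc _) (a ∷ _) = isEven a

P : Fin 2 → ℕ → ℕ → ℕ
P j k m = length (filter (λ σ → T? ((desE σ ≡ᵇ k) ∧ firstOK j σ)) (perms m))

Pℤ : Fin 2 → ℤ → ℕ → ℕ
Pℤ j (+ k)      m = P j k m
Pℤ j -[1+ _ ]   m = 0

module Submission where

-- Inserting the largest letter m + 1 into all slots of the words of S_m gives S_{m+1}, and the
-- effect on the table P_{j,k,m} is an explicit linear recurrence (insertMax) whose coefficients
-- only involve the numbers of odd and even letters.  Solving it by induction on n gives
--   P_{0,k,2n+1} = n! (n+1)! C(n,k)²,     P_{1,k,2n+1} = n! (n+1)! C(n,k) C(n,k+1),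
-- together with similar formulas at the even lengths, and both symmetries then come from
-- C(n,k) = C(n,n-k).

open import Defs
open import Data.Nat using (ℕ; _≤_; _+_; _*_)
open import Data.Fin using (zero; suc)
open import Data.Integer using (+_) renaming (_-_ to _-ℤ_)
open import Data.Product using (_×_)
open import Relation.Binary.PropositionalEquality using (_≡_)

open import Data.Bool using (Bool; true; false; _∧_; not; T; T?)
open import Data.Bool.Properties using (∧-identityʳ; ∧-zeroʳ; T-≡)
open import Data.Fin using (Fin; toℕ)
open import Data.Integer.Properties using ([+m]-[+n]≡m⊖n; ⊖-≥)
open import Data.List using (List; []; _∷_; map; filter; length; _++_; concatMap)
open import Data.List.Properties using (filter-++; length-++; map-∘; map-cong)
open import Data.List.Relation.Unary.All using (All; []; _∷_)
import Data.List.Relation.Unary.All as All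
open import Data.List.Relation.Unary.All.Properties using (map⁺; concat⁺)
open import Data.Nat using (zero; suc; _∸_; _!; _<_; _<ᵇ_; _≡ᵇ_; s≤s; z≤n)
open import Data.Nat.Combinatorics
  using (_C_; nC1≡n; k>n⇒nCk≡0; nCk≡nC[n∸k]) renaming (nCk+nC[k+1]≡[n+1]C[k+1] to pascal)
open import Data.Nat.Properties
open import Algebra.Properties.CommutativeSemigroup +-commutativeSemigroup using (x∙yz≈y∙xz; interchange)
open import Data.Nat.Tactic.RingSolver using (solve-∀)
open import Data.Product using (_,_)
open import Function using (_∘_; id; Equivalence)
open import Relation.Binary.PropositionalEquality using (refl; sym; trans; cong; cong₂; subst; module ≡-Reasoning)
open import Relation.Nullary using (contradiction; yes; no)

⟦_⟧ : Bool → ℕ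
⟦ true ⟧  = 1
⟦ false ⟧ = 0

⟦∧⟧ : ∀ b c → ⟦ b ∧ c ⟧ ≡ ⟦ c ⟧ * ⟦ b ⟧
⟦∧⟧ true  true  = refl
⟦∧⟧ true  false = refl
⟦∧⟧ false true  = refl
⟦∧⟧ false false = refl

countWhere : {A : Set} → (A → Bool) → List A → ℕ
countWhere p xs = length (filter (λ x → T? (p x)) xs)

module _ {A : Set} where

  countWhere-cons : ∀ (p : A → Bool) x xs → countWhere p (x ∷ xs) ≡ ⟦ p x ⟧ + countWhere p xs
  countWhere-cons p x xs with p x
  ... | true  = refl
  ... | false = refl

  countWhere-++ : ∀ (p : A → Bool) xs ys → countWhere p (xs ++ ys) ≡ countWhere p xs + countWhere p ys
  countWhere-++ p xs ys = trans (cong length (filter-++ (λ x → T? (p x)) xs ys)) (length-++ (filter _ xs))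

  countWhere-cong : ∀ {p q : A → Bool} → (∀ x → p x ≡ q x) → ∀ xs → countWhere p xs ≡ countWhere q xs
  countWhere-cong p≗q []       = refl
  countWhere-cong {p} {q} p≗q (x ∷ xs) = begin
    countWhere p (x ∷ xs)        ≡⟨ countWhere-cons p x xs ⟩
    ⟦ p x ⟧ + countWhere p xs   ≡⟨ cong₂ _+_ (cong ⟦_⟧ (p≗q x)) (countWhere-cong p≗q xs) ⟩
    ⟦ q x ⟧ + countWhere q xs   ≡⟨ countWhere-cons q x xs ⟨
    countWhere q (x ∷ xs)        ∎
    where open ≡-Reasoning

  countWhere-∧ʳ : ∀ (p : A → Bool) c xs → countWhere (λ x → p x ∧ c) xs ≡ ⟦ c ⟧ * countWhere p xs
  countWhere-∧ʳ p c []       = sym (*-zeroʳ ⟦ c ⟧)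
  countWhere-∧ʳ p c (x ∷ xs) = begin
    countWhere (λ x → p x ∧ c) (x ∷ xs)                ≡⟨ countWhere-cons _ x xs ⟩
    ⟦ p x ∧ c ⟧ + countWhere (λ x → p x ∧ c) xs        ≡⟨ cong₂ _+_ (⟦∧⟧ (p x) c) (countWhere-∧ʳ p c xs) ⟩
    ⟦ c ⟧ * ⟦ p x ⟧ + ⟦ c ⟧ * countWhere p xs          ≡⟨ *-distribˡ-+ ⟦ c ⟧ _ _ ⟨
    ⟦ c ⟧ * (⟦ p x ⟧ + countWhere p xs)                ≡⟨ cong (⟦ c ⟧ *_) (countWhere-cons p x xs) ⟨
    ⟦ c ⟧ * countWhere p (x ∷ xs)                      ∎
    where open ≡-Reasoning

countWhere-map : ∀ {A B : Set} (p : B → Bool) (f : A → B) xs → countWhere p (map f xs) ≡ countWhere (p ∘ f) xs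
countWhere-map p f []       = refl
countWhere-map p f (x ∷ xs) =
  trans (countWhere-cons p (f x) (map f xs))
        (trans (cong (_+_ ⟦ p (f x) ⟧) (countWhere-map p f xs)) (sym (countWhere-cons (p ∘ f) x xs)))

countWhere-⟦⟧+≡ᵇ : ∀ D d rs →
  countWhere (λ r → ⟦ r ⟧ + D ≡ᵇ d) rs ≡ ⟦ D ≡ᵇ d ⟧ * countWhere not rs + ⟦ suc D ≡ᵇ d ⟧ * countWhere id rs
countWhere-⟦⟧+≡ᵇ D d []       = sym (cong₂ _+_ (*-zeroʳ ⟦ D ≡ᵇ d ⟧) (*-zeroʳ ⟦ suc D ≡ᵇ d ⟧))
countWhere-⟦⟧+≡ᵇ D d (r ∷ rs) = begin
  countWhere (λ r → ⟦ r ⟧ + D ≡ᵇ d) (r ∷ rs)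
    ≡⟨ countWhere-cons _ r rs ⟩
  ⟦ ⟦ r ⟧ + D ≡ᵇ d ⟧ + countWhere (λ r → ⟦ r ⟧ + D ≡ᵇ d) rs
    ≡⟨ cong (_+_ ⟦ ⟦ r ⟧ + D ≡ᵇ d ⟧) (countWhere-⟦⟧+≡ᵇ D d rs) ⟩
  ⟦ ⟦ r ⟧ + D ≡ᵇ d ⟧ + (⟦ D ≡ᵇ d ⟧ * countWhere not rs + ⟦ suc D ≡ᵇ d ⟧ * countWhere id rs)
    ≡⟨ split r ⟩
  ⟦ D ≡ᵇ d ⟧ * (⟦ not r ⟧ + countWhere not rs) + ⟦ suc D ≡ᵇ d ⟧ * (⟦ r ⟧ + countWhere id rs)
    ≡⟨ cong₂ (λ f t → ⟦ D ≡ᵇ d ⟧ * f + ⟦ suc D ≡ᵇ d ⟧ * t) (countWhere-cons not r rs) (countWhere-cons id r rs) ⟨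
  ⟦ D ≡ᵇ d ⟧ * countWhere not (r ∷ rs) + ⟦ suc D ≡ᵇ d ⟧ * countWhere id (r ∷ rs) ∎
  where
  open ≡-Reasoning
  split : ∀ r → ⟦ ⟦ r ⟧ + D ≡ᵇ d ⟧ + (⟦ D ≡ᵇ d ⟧ * countWhere not rs + ⟦ suc D ≡ᵇ d ⟧ * countWhere id rs)
              ≡ ⟦ D ≡ᵇ d ⟧ * (⟦ not r ⟧ + countWhere not rs) + ⟦ suc D ≡ᵇ d ⟧ * (⟦ r ⟧ + countWhere id rs)
  split true  = lemma ⟦ suc D ≡ᵇ d ⟧ ⟦ D ≡ᵇ d ⟧ _ _
    where lemma : ∀ y x f r → y + (x * f + y * r) ≡ x * f + y * suc r
          lemma = solve-∀
  split false = lemma ⟦ D ≡ᵇ d ⟧ ⟦ suc D ≡ᵇ d ⟧ _ _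
    where lemma : ∀ x y f r → x + (x * f + y * r) ≡ x * suc f + y * r
          lemma = solve-∀

count : Fin 2 → ℕ → List (List ℕ) → ℕ
count j d = countWhere (λ σ → (desE σ ≡ᵇ d) ∧ firstOK j σ)

parityIs : Fin 2 → Bool → Bool
parityIs zero    e = not e
parityIs (suc _) e = e

firstOK-cons : ∀ j a σ → firstOK j (a ∷ σ) ≡ parityIs j (isEven a)
firstOK-cons zero    a σ = refl
firstOK-cons (suc _) a σ = refl

odds evens : List ℕ → ℕ
odds  = countWhere (not ∘ isEven)
evens = countWhere isEven

desE-cons : ∀ a b σ → desE (a ∷ b ∷ σ) ≡ ⟦ (b <ᵇ a) ∧ isEven b ⟧ + desE (b ∷ σ)
desE-cons a b σ with (b <ᵇ a) ∧ isEven b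
... | true  = refl
... | false = refl

<⇒<ᵇ≡true : ∀ {m n} → m < n → (m <ᵇ n) ≡ true
<⇒<ᵇ≡true m<n = Equivalence.to T-≡ (<⇒<ᵇ m<n)

<⇒>ᵇ≡false : ∀ {m n} → m < n → (n <ᵇ m) ≡ false
<⇒>ᵇ≡false {m} {n} m<n with n <ᵇ m in eq
... | false = refl
... | true  = contradiction (<ᵇ⇒< n m (subst T (sym eq) _)) (<⇒≯ m<n)

-- One flag per slot after the first letter a of a ∷ σ: it is set when inserting a letter larger
-- than all of a ∷ σ there creates a new even descent, i.e. when the next letter is even and
-- above its predecessor.
slotRises : ℕ → List ℕ → List Bool
slotRises a []      = false ∷ []
slotRises a (b ∷ σ) = (not (b <ᵇ a) ∧ isEven b) ∷ slotRises b σ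

desE-insertions : ∀ {x} a σ → All (_< x) (a ∷ σ) →
  map (λ τ → desE (a ∷ τ)) (insertions x σ) ≡ map (λ r → ⟦ r ⟧ + desE (a ∷ σ)) (slotRises a σ)
desE-insertions {x} a []      (a<x ∷ []) rewrite <⇒>ᵇ≡false a<x = refl
desE-insertions {x} a (b ∷ σ) (a<x ∷ b<σ) = cong₂ _∷_ insertedAfterA insertedLater
  where
  open ≡-Reasoning
  B = (b <ᵇ a) ∧ isEven b
  insertedAfterA : desE (a ∷ x ∷ b ∷ σ) ≡ ⟦ not (b <ᵇ a) ∧ isEven b ⟧ + desE (a ∷ b ∷ σ)
  insertedAfterA rewrite <⇒>ᵇ≡false a<x | <⇒<ᵇ≡true (All.head b<σ) with b <ᵇ a | isEven b
  ... | true  | true  = refl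
  ... | true  | false = refl
  ... | false | true  = refl
  ... | false | false = refl
  insertedLater : map (λ τ → desE (a ∷ τ)) (map (b ∷_) (insertions x σ))
                ≡ map (λ r → ⟦ r ⟧ + desE (a ∷ b ∷ σ)) (slotRises b σ)
  insertedLater = begin
    map (λ τ → desE (a ∷ τ)) (map (b ∷_) (insertions x σ))
      ≡⟨ map-∘ (insertions x σ) ⟨
    map (λ τ → desE (a ∷ b ∷ τ)) (insertions x σ)
      ≡⟨ map-cong (λ τ → desE-cons a b τ) (insertions x σ) ⟩
    map (λ τ → ⟦ B ⟧ + desE (b ∷ τ)) (insertions x σ)
      ≡⟨ map-∘ (insertions x σ) ⟩
    map (_+_ ⟦ B ⟧) (map (λ τ → desE (b ∷ τ)) (insertions x σ))
      ≡⟨ cong (map (_+_ ⟦ B ⟧)) (desE-insertions b σ b<σ) ⟩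
    map (_+_ ⟦ B ⟧) (map (λ r → ⟦ r ⟧ + desE (b ∷ σ)) (slotRises b σ))
      ≡⟨ map-∘ (slotRises b σ) ⟨
    map (λ r → ⟦ B ⟧ + (⟦ r ⟧ + desE (b ∷ σ))) (slotRises b σ)
      ≡⟨ map-cong (λ r → trans (x∙yz≈y∙xz ⟦ B ⟧ ⟦ r ⟧ _) (cong (_+_ ⟦ r ⟧) (sym (desE-cons a b σ)))) (slotRises b σ) ⟩
    map (λ r → ⟦ r ⟧ + desE (a ∷ b ∷ σ)) (slotRises b σ) ∎

slotRises-true+desE≡evens : ∀ a σ → countWhere id (slotRises a σ) + desE (a ∷ σ) ≡ evens σ
slotRises-true+desE≡evens a []      = refl
slotRises-true+desE≡evens a (b ∷ σ) = begin
  countWhere id (slotRises a (b ∷ σ)) + desE (a ∷ b ∷ σ)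
    ≡⟨ cong₂ _+_ (countWhere-cons id (not B ∧ E) (slotRises b σ)) (desE-cons a b σ) ⟩
  (⟦ not B ∧ E ⟧ + countWhere id (slotRises b σ)) + (⟦ B ∧ E ⟧ + desE (b ∷ σ))
    ≡⟨ interchange ⟦ not B ∧ E ⟧ _ _ _ ⟩
  (⟦ not B ∧ E ⟧ + ⟦ B ∧ E ⟧) + (countWhere id (slotRises b σ) + desE (b ∷ σ))
    ≡⟨ cong₂ _+_ (even-after B E) (slotRises-true+desE≡evens b σ) ⟩
  ⟦ E ⟧ + evens σ
    ≡⟨ countWhere-cons isEven b σ ⟨
  evens (b ∷ σ) ∎
  where
  open ≡-Reasoning
  B = b <ᵇ a
  E = isEven b
  even-after : ∀ B E → ⟦ not B ∧ E ⟧ + ⟦ B ∧ E ⟧ ≡ ⟦ E ⟧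
  even-after true  E     = refl
  even-after false true  = refl
  even-after false false = refl

slotRises-false≡1+odds+desE : ∀ a σ → countWhere not (slotRises a σ) ≡ suc (odds σ + desE (a ∷ σ))
slotRises-false≡1+odds+desE a []      = refl
slotRises-false≡1+odds+desE a (b ∷ σ) = begin
  countWhere not (slotRises a (b ∷ σ))
    ≡⟨ countWhere-cons not (not B ∧ E) (slotRises b σ) ⟩
  ⟦ not (not B ∧ E) ⟧ + countWhere not (slotRises b σ)
    ≡⟨ cong₂ _+_ (flat-after B E) (slotRises-false≡1+odds+desE b σ) ⟩
  (⟦ not E ⟧ + ⟦ B ∧ E ⟧) + suc (odds σ + desE (b ∷ σ))
    ≡⟨ rearrange ⟦ not E ⟧ ⟦ B ∧ E ⟧ (odds σ) (desE (b ∷ σ)) ⟩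
  suc ((⟦ not E ⟧ + odds σ) + (⟦ B ∧ E ⟧ + desE (b ∷ σ)))
    ≡⟨ cong suc (cong₂ _+_ (countWhere-cons (not ∘ isEven) b σ) (desE-cons a b σ)) ⟨
  suc (odds (b ∷ σ) + desE (a ∷ b ∷ σ)) ∎
  where
  open ≡-Reasoning
  B = b <ᵇ a
  E = isEven b
  flat-after : ∀ B E → ⟦ not (not B ∧ E) ⟧ ≡ ⟦ not E ⟧ + ⟦ B ∧ E ⟧
  flat-after true  true  = refl
  flat-after true  false = refl
  flat-after false true  = refl
  flat-after false false = refl
  rearrange : ∀ x y o D → (x + y) + suc (o + D) ≡ suc ((x + o) + (y + D))
  rearrange = solve-∀

Table : Set
Table = Fin 2 → ℕ → ℕ

wordTable : List ℕ → Table
wordTable σ j d = ⟦ (desE σ ≡ᵇ d) ∧ firstOK j σ ⟧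

count-cons : ∀ j d σ W → count j d (σ ∷ W) ≡ wordTable σ j d + count j d W
count-cons j d σ W = countWhere-cons _ σ W

shift : (ℕ → ℕ) → ℕ → ℕ
shift f zero    = 0
shift f (suc d) = f d

-- Inserting a new largest letter of parity p into words with o odd and e even letters turns
-- the table T into this one.  In front, the word moves to class p and gains an even descent iff
-- its first letter is even.  Elsewhere the class j (toℕ j = 1 iff the first letter is even) is
-- kept, and of the o + e slots exactly e ∸ j ∸ d, one before each even ascent top, add an even
-- descent, while the other o + j + d do not.
insertMax : (o e : ℕ) → Bool → Table → Table
insertMax o e p T j d =
  ⟦ parityIs j p ⟧ * (T zero d + shift (T (suc zero)) d)
  + ((o + toℕ j + d) * T j d + shift (λ d′ → (e ∸ toℕ j ∸ d′) * T j d′) d)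

count-map-∷ : ∀ j d a V →
  count j d (map (a ∷_) V) ≡ ⟦ parityIs j (isEven a) ⟧ * countWhere (λ τ → desE (a ∷ τ) ≡ᵇ d) V
count-map-∷ j d a V = begin
  count j d (map (a ∷_) V)
    ≡⟨ countWhere-map _ (a ∷_) V ⟩
  countWhere (λ τ → (desE (a ∷ τ) ≡ᵇ d) ∧ firstOK j (a ∷ τ)) V
    ≡⟨ countWhere-cong (λ τ → cong ((desE (a ∷ τ) ≡ᵇ d) ∧_) (firstOK-cons j a τ)) V ⟩
  countWhere (λ τ → (desE (a ∷ τ) ≡ᵇ d) ∧ parityIs j (isEven a)) V
    ≡⟨ countWhere-∧ʳ (λ τ → desE (a ∷ τ) ≡ᵇ d) _ V ⟩
  ⟦ parityIs j (isEven a) ⟧ * countWhere (λ τ → desE (a ∷ τ) ≡ᵇ d) V ∎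
  where open ≡-Reasoning

count-map-∷-insertions : ∀ {x} j d a σ → All (_< x) (a ∷ σ) →
  count j d (map (a ∷_) (insertions x σ))
    ≡ ⟦ parityIs j (isEven a) ⟧ * (⟦ desE (a ∷ σ) ≡ᵇ d ⟧ * countWhere not (slotRises a σ)
                                  + ⟦ suc (desE (a ∷ σ)) ≡ᵇ d ⟧ * countWhere id (slotRises a σ))
count-map-∷-insertions {x} j d a σ a∷σ<x = begin
  count j d (map (a ∷_) (insertions x σ))
    ≡⟨ count-map-∷ j d a (insertions x σ) ⟩
  ⟦ c ⟧ * countWhere (λ τ → desE (a ∷ τ) ≡ᵇ d) (insertions x σ)
    ≡⟨ cong (⟦ c ⟧ *_) (countWhere-map (_≡ᵇ d) (λ τ → desE (a ∷ τ)) (insertions x σ)) ⟨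
  ⟦ c ⟧ * countWhere (_≡ᵇ d) (map (λ τ → desE (a ∷ τ)) (insertions x σ))
    ≡⟨ cong (λ ds → ⟦ c ⟧ * countWhere (_≡ᵇ d) ds) (desE-insertions a σ a∷σ<x) ⟩
  ⟦ c ⟧ * countWhere (_≡ᵇ d) (map (λ r → ⟦ r ⟧ + D) (slotRises a σ))
    ≡⟨ cong (⟦ c ⟧ *_) (countWhere-map (_≡ᵇ d) (λ r → ⟦ r ⟧ + D) (slotRises a σ)) ⟩
  ⟦ c ⟧ * countWhere (λ r → ⟦ r ⟧ + D ≡ᵇ d) (slotRises a σ)
    ≡⟨ cong (⟦ c ⟧ *_) (countWhere-⟦⟧+≡ᵇ D d (slotRises a σ)) ⟩
  ⟦ c ⟧ * (⟦ D ≡ᵇ d ⟧ * countWhere not (slotRises a σ) + ⟦ suc D ≡ᵇ d ⟧ * countWhere id (slotRises a σ)) ∎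
  where
  open ≡-Reasoning
  c = parityIs j (isEven a)
  D = desE (a ∷ σ)

wordTable-front : ∀ D s d →
  ⟦ (D ≡ᵇ d) ∧ not s ⟧ + shift (λ d′ → ⟦ (D ≡ᵇ d′) ∧ s ⟧) d ≡ ⟦ ⟦ s ⟧ + D ≡ᵇ d ⟧
wordTable-front D false zero    rewrite ∧-identityʳ (D ≡ᵇ 0) = +-identityʳ _
wordTable-front D false (suc d) rewrite ∧-identityʳ (D ≡ᵇ suc d) | ∧-zeroʳ (D ≡ᵇ d) = +-identityʳ _
wordTable-front D true  zero    rewrite ∧-zeroʳ (D ≡ᵇ 0) = refl
wordTable-front D true  (suc d) rewrite ∧-zeroʳ (D ≡ᵇ suc d) | ∧-identityʳ (D ≡ᵇ d) = refl

*-⟦∧⟧ : ∀ b c {m n} → (T b → T c → m ≡ n) → m * ⟦ b ∧ c ⟧ ≡ ⟦ c ⟧ * (⟦ b ⟧ * n)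
*-⟦∧⟧ true  true  {m} {n} m≡n = trans (*-identityʳ m) (trans (m≡n _ _) (sym (trans (*-identityˡ _) (*-identityˡ n))))
*-⟦∧⟧ true  false {m} _   = *-zeroʳ m
*-⟦∧⟧ false c     {m} _   = trans (*-zeroʳ m) (sym (*-zeroʳ ⟦ c ⟧))

class-index : ∀ j a σ → T (firstOK j (a ∷ σ)) → toℕ j ≡ ⟦ isEven a ⟧
class-index zero    a σ _ with isEven a
... | false = refl
class-index (suc zero) a σ _ with isEven a
... | true = refl

count-insertions : ∀ {x} a σ → All (_< x) (a ∷ σ) → ∀ j d →
  count j d (insertions x (a ∷ σ)) ≡ insertMax (odds (a ∷ σ)) (evens (a ∷ σ)) (isEven x) (wordTable (a ∷ σ)) j d
count-insertions {x} a σ a∷σ<x j d = begin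
  count j d (insertions x (a ∷ σ))
    ≡⟨ count-cons j d (x ∷ a ∷ σ) _ ⟩
  wordTable (x ∷ a ∷ σ) j d + count j d (map (a ∷_) (insertions x σ))
    ≡⟨ cong₂ _+_ inFront behindFirst ⟩
  ⟦ parityIs j (isEven x) ⟧ * ⟦ ⟦ s ⟧ + D ≡ᵇ d ⟧ + ⟦ c ⟧ * (⟦ D ≡ᵇ d ⟧ * F + ⟦ suc D ≡ᵇ d ⟧ * R)
    ≡⟨ cong₂ _+_ (cong (⟦ parityIs j (isEven x) ⟧ *_) (wordTable-front D s d)) behind ⟨
  insertMax o e (isEven x) (wordTable (a ∷ σ)) j d ∎
  where
  open ≡-Reasoning
  s = isEven a
  c = firstOK j (a ∷ σ)
  D = desE (a ∷ σ)
  F = countWhere not (slotRises a σ)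
  R = countWhere id (slotRises a σ)
  o = odds (a ∷ σ)
  e = evens (a ∷ σ)
  behindFirst : count j d (map (a ∷_) (insertions x σ)) ≡ ⟦ c ⟧ * (⟦ D ≡ᵇ d ⟧ * F + ⟦ suc D ≡ᵇ d ⟧ * R)
  behindFirst = trans (count-map-∷-insertions j d a σ a∷σ<x) (cong (λ b → ⟦ b ⟧ * _) (sym (firstOK-cons j a σ)))
  inFront : wordTable (x ∷ a ∷ σ) j d ≡ ⟦ parityIs j (isEven x) ⟧ * ⟦ ⟦ s ⟧ + D ≡ᵇ d ⟧
  inFront = begin
    ⟦ (desE (x ∷ a ∷ σ) ≡ᵇ d) ∧ firstOK j (x ∷ a ∷ σ) ⟧
      ≡⟨ ⟦∧⟧ (desE (x ∷ a ∷ σ) ≡ᵇ d) (firstOK j (x ∷ a ∷ σ)) ⟩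
    ⟦ firstOK j (x ∷ a ∷ σ) ⟧ * ⟦ desE (x ∷ a ∷ σ) ≡ᵇ d ⟧
      ≡⟨ cong₂ (λ f n → ⟦ f ⟧ * ⟦ n ≡ᵇ d ⟧) (firstOK-cons j x (a ∷ σ)) (desE-cons x a σ) ⟩
    ⟦ parityIs j (isEven x) ⟧ * ⟦ ⟦ (a <ᵇ x) ∧ s ⟧ + D ≡ᵇ d ⟧
      ≡⟨ cong (λ b → ⟦ parityIs j (isEven x) ⟧ * ⟦ ⟦ b ∧ s ⟧ + D ≡ᵇ d ⟧) (<⇒<ᵇ≡true (All.head a∷σ<x)) ⟩
    ⟦ parityIs j (isEven x) ⟧ * ⟦ ⟦ s ⟧ + D ≡ᵇ d ⟧ ∎
  flat : T (D ≡ᵇ d) → T c → o + toℕ j + d ≡ F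
  flat D≡d j≡s = begin
    o + toℕ j + d                 ≡⟨ cong₂ (λ i n → o + i + n) (class-index j a σ j≡s) (sym (≡ᵇ⇒≡ D d D≡d)) ⟩
    o + ⟦ s ⟧ + D                 ≡⟨ cong (λ n → n + ⟦ s ⟧ + D) (countWhere-cons (not ∘ isEven) a σ) ⟩
    ⟦ not s ⟧ + odds σ + ⟦ s ⟧ + D ≡⟨ odd-or-even s ⟩
    suc (odds σ + D)              ≡⟨ slotRises-false≡1+odds+desE a σ ⟨
    F                             ∎
    where
    odd-or-even : ∀ s → ⟦ not s ⟧ + odds σ + ⟦ s ⟧ + D ≡ suc (odds σ + D)
    odd-or-even false = cong (λ n → suc (n + D)) (+-identityʳ (odds σ))
    odd-or-even true  = cong (_+ D) (+-comm (odds σ) 1)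
  rising : ∀ {d} → T (D ≡ᵇ d) → T c → e ∸ toℕ j ∸ d ≡ R
  rising {d} D≡d j≡s = begin
    e ∸ toℕ j ∸ d              ≡⟨ cong₂ (λ i n → e ∸ i ∸ n) (class-index j a σ j≡s) (sym (≡ᵇ⇒≡ D d D≡d)) ⟩
    e ∸ ⟦ s ⟧ ∸ D              ≡⟨ cong (λ n → n ∸ ⟦ s ⟧ ∸ D) (countWhere-cons isEven a σ) ⟩
    ⟦ s ⟧ + evens σ ∸ ⟦ s ⟧ ∸ D ≡⟨ cong (_∸ D) (m+n∸m≡n ⟦ s ⟧ (evens σ)) ⟩
    evens σ ∸ D                ≡⟨ cong (_∸ D) (slotRises-true+desE≡evens a σ) ⟨
    R + D ∸ D                  ≡⟨ m+n∸n≡m R D ⟩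
    R                          ∎
  shifted : ∀ d → shift (λ d′ → (e ∸ toℕ j ∸ d′) * wordTable (a ∷ σ) j d′) d ≡ ⟦ c ⟧ * (⟦ suc D ≡ᵇ d ⟧ * R)
  shifted zero    = sym (*-zeroʳ ⟦ c ⟧)
  shifted (suc d) = *-⟦∧⟧ (D ≡ᵇ d) c rising
  behind : (o + toℕ j + d) * wordTable (a ∷ σ) j d + shift (λ d′ → (e ∸ toℕ j ∸ d′) * wordTable (a ∷ σ) j d′) d
         ≡ ⟦ c ⟧ * (⟦ D ≡ᵇ d ⟧ * F + ⟦ suc D ≡ᵇ d ⟧ * R)
  behind = trans (cong₂ _+_ (*-⟦∧⟧ (D ≡ᵇ d) c flat) (shifted d)) (sym (*-distribˡ-+ ⟦ c ⟧ _ _))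

insertMax-cong : ∀ o e p {T U : Table} → (∀ j d → T j d ≡ U j d) → ∀ j d → insertMax o e p T j d ≡ insertMax o e p U j d
insertMax-cong o e p T≗U j zero    =
  cong₂ (λ f t → ⟦ parityIs j p ⟧ * (f + 0) + ((o + toℕ j + 0) * t + 0)) (T≗U zero 0) (T≗U j 0)
insertMax-cong o e p T≗U j (suc d) =
  cong₂ _+_ (cong (⟦ parityIs j p ⟧ *_) (cong₂ _+_ (T≗U zero (suc d)) (T≗U (suc zero) d)))
            (cong₂ _+_ (cong ((o + toℕ j + suc d) *_) (T≗U j (suc d))) (cong ((e ∸ toℕ j ∸ d) *_) (T≗U j d)))

insertMax-zero : ∀ o e p j d → insertMax o e p (λ _ _ → 0) j d ≡ 0
insertMax-zero o e p j zero    = lemma ⟦ parityIs j p ⟧ (o + toℕ j + 0)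
  where lemma : ∀ c m → c * (0 + 0) + (m * 0 + 0) ≡ 0
        lemma = solve-∀
insertMax-zero o e p j (suc d) = lemma ⟦ parityIs j p ⟧ (o + toℕ j + suc d) (e ∸ toℕ j ∸ d)
  where lemma : ∀ c m n → c * (0 + 0) + (m * 0 + n * 0) ≡ 0
        lemma = solve-∀

insertMax-+ : ∀ o e p (T U : Table) j d →
  insertMax o e p (λ j d → T j d + U j d) j d ≡ insertMax o e p T j d + insertMax o e p U j d
insertMax-+ o e p T U j zero    =
  lemma ⟦ parityIs j p ⟧ (o + toℕ j + 0) (T zero 0) (U zero 0) (T j 0) (U j 0)
  where lemma : ∀ c m f g t u → c * ((f + g) + 0) + (m * (t + u) + 0) ≡ (c * (f + 0) + (m * t + 0)) + (c * (g + 0) + (m * u + 0))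
        lemma = solve-∀
insertMax-+ o e p T U j (suc d) =
  lemma ⟦ parityIs j p ⟧ (o + toℕ j + suc d) (e ∸ toℕ j ∸ d)
        (T zero (suc d)) (U zero (suc d)) (T (suc zero) d) (U (suc zero) d) (T j (suc d)) (U j (suc d)) (T j d) (U j d)
  where lemma : ∀ c m n f g f′ g′ t u t′ u′ →
          c * ((f + g) + (f′ + g′)) + (m * (t + u) + n * (t′ + u′))
            ≡ (c * (f + f′) + (m * t + n * t′)) + (c * (g + g′) + (m * u + n * u′))
        lemma = solve-∀

insertMax-* : ∀ o e p k (T : Table) j d → insertMax o e p (λ j d → k * T j d) j d ≡ k * insertMax o e p T j d
insertMax-* o e p k T j zero    = lemma ⟦ parityIs j p ⟧ (o + toℕ j + 0) k (T zero 0) (T j 0)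
  where lemma : ∀ c m k f t → c * (k * f + 0) + (m * (k * t) + 0) ≡ k * (c * (f + 0) + (m * t + 0))
        lemma = solve-∀
insertMax-* o e p k T j (suc d) =
  lemma ⟦ parityIs j p ⟧ (o + toℕ j + suc d) (e ∸ toℕ j ∸ d) k (T zero (suc d)) (T (suc zero) d) (T j (suc d)) (T j d)
  where lemma : ∀ c m n k f f′ t t′ → c * (k * f + k * f′) + (m * (k * t) + n * (k * t′)) ≡ k * (c * (f + f′) + (m * t + n * t′))
        lemma = solve-∀

evensUpTo oddsUpTo : ℕ → ℕ
evensUpTo zero    = 0
evensUpTo (suc m) = ⟦ isEven (suc m) ⟧ + evensUpTo m
oddsUpTo zero    = 0
oddsUpTo (suc m) = ⟦ not (isEven (suc m)) ⟧ + oddsUpTo m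

oddsUpTo-positive : ∀ m → 0 < oddsUpTo (suc m)
oddsUpTo-positive zero    = s≤s z≤n
oddsUpTo-positive (suc m) = ≤-trans (oddsUpTo-positive m) (m≤n+m _ ⟦ not (isEven (suc (suc m))) ⟧)

WordOf : ℕ → List ℕ → Set
WordOf m σ = All (_< suc m) σ × odds σ ≡ oddsUpTo m × evens σ ≡ evensUpTo m

insertions-below : ∀ {x y} σ → x < y → All (_< y) σ → All (All (_< y)) (insertions x σ)
insertions-below []      x<y []          = (x<y ∷ []) ∷ []
insertions-below (b ∷ σ) x<y (b<y ∷ σ<y) =
  (x<y ∷ b<y ∷ σ<y) ∷ map⁺ (All.map (b<y ∷_) (insertions-below σ x<y σ<y))

insertions-countWhere : ∀ (p : ℕ → Bool) x σ →
  All (λ τ → countWhere p τ ≡ ⟦ p x ⟧ + countWhere p σ) (insertions x σ)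
insertions-countWhere p x []      = countWhere-cons p x [] ∷ []
insertions-countWhere p x (b ∷ σ) =
  countWhere-cons p x (b ∷ σ) ∷ map⁺ (All.map later (insertions-countWhere p x σ))
  where
  later : ∀ {τ} → countWhere p τ ≡ ⟦ p x ⟧ + countWhere p σ → countWhere p (b ∷ τ) ≡ ⟦ p x ⟧ + countWhere p (b ∷ σ)
  later {τ} τ-count = begin
    countWhere p (b ∷ τ)                       ≡⟨ countWhere-cons p b τ ⟩
    ⟦ p b ⟧ + countWhere p τ                   ≡⟨ cong (_+_ ⟦ p b ⟧) τ-count ⟩
    ⟦ p b ⟧ + (⟦ p x ⟧ + countWhere p σ)       ≡⟨ x∙yz≈y∙xz ⟦ p b ⟧ ⟦ p x ⟧ _ ⟩
    ⟦ p x ⟧ + (⟦ p b ⟧ + countWhere p σ)       ≡⟨ cong (_+_ ⟦ p x ⟧) (countWhere-cons p b σ) ⟨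
    ⟦ p x ⟧ + countWhere p (b ∷ σ)             ∎
    where open ≡-Reasoning

perms-WordOf : ∀ m → All (WordOf m) (perms m)
perms-WordOf zero    = ([] , refl , refl) ∷ []
perms-WordOf (suc m) = concat⁺ (map⁺ (All.map extend (perms-WordOf m)))
  where
  extend : ∀ {σ} → WordOf m σ → All (WordOf (suc m)) (insertions (suc m) σ)
  extend {σ} (σ-below , σ-odds , σ-evens) = All.zipWith
    (λ (τ-below , τ-odds , τ-evens) →
       τ-below , trans τ-odds (cong (_+_ _) σ-odds) , trans τ-evens (cong (_+_ _) σ-evens))
    ( insertions-below σ (n<1+n (suc m)) (All.map m<n⇒m<1+n σ-below)
    , All.zip (insertions-countWhere (not ∘ isEven) (suc m) σ , insertions-countWhere isEven (suc m) σ))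

count-++ : ∀ j d V W → count j d (V ++ W) ≡ count j d V + count j d W
count-++ j d = countWhere-++ _

count-insertMax : ∀ m W → All (WordOf (suc m)) W → ∀ j d →
  count j d (concatMap (insertions (suc (suc m))) W)
    ≡ insertMax (oddsUpTo (suc m)) (evensUpTo (suc m)) (isEven (suc (suc m))) (λ j d → count j d W) j d
count-insertMax m [] [] j d =
  sym (insertMax-zero (oddsUpTo (suc m)) (evensUpTo (suc m)) (isEven (suc (suc m))) j d)
count-insertMax m ([] ∷ W) ((_ , no-odds , _) ∷ _) j d = contradiction no-odds (<⇒≢ (oddsUpTo-positive m))
count-insertMax m ((a ∷ σ) ∷ W) ((below , σ-odds , σ-evens) ∷ W-ok) j d = begin
  count j d (insertions x (a ∷ σ) ++ concatMap (insertions x) W)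
    ≡⟨ count-++ j d (insertions x (a ∷ σ)) _ ⟩
  count j d (insertions x (a ∷ σ)) + count j d (concatMap (insertions x) W)
    ≡⟨ cong₂ _+_ (count-insertions a σ below j d) (count-insertMax m W W-ok j d) ⟩
  insertMax (odds (a ∷ σ)) (evens (a ∷ σ)) p (wordTable (a ∷ σ)) j d + insertMax o e p (λ j d → count j d W) j d
    ≡⟨ cong₂ (λ o′ e′ → insertMax o′ e′ p (wordTable (a ∷ σ)) j d + insertMax o e p (λ j d → count j d W) j d) σ-odds σ-evens ⟩
  insertMax o e p (wordTable (a ∷ σ)) j d + insertMax o e p (λ j d → count j d W) j d
    ≡⟨ insertMax-+ o e p (wordTable (a ∷ σ)) (λ j d → count j d W) j d ⟨
  insertMax o e p (λ j d → wordTable (a ∷ σ) j d + count j d W) j d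
    ≡⟨ insertMax-cong o e p (λ j d → sym (count-cons j d (a ∷ σ) W)) j d ⟩
  insertMax o e p (λ j d → count j d ((a ∷ σ) ∷ W)) j d ∎
  where
  open ≡-Reasoning
  x = suc (suc m)
  o = oddsUpTo (suc m)
  e = evensUpTo (suc m)
  p = isEven x

P-recurrence : ∀ m j d →
  P j d (suc (suc m)) ≡ insertMax (oddsUpTo (suc m)) (evensUpTo (suc m)) (isEven (suc (suc m))) (λ j d → P j d (suc m)) j d
P-recurrence m = count-insertMax m (perms (suc m)) (perms-WordOf (suc m))

absorption-sum : ∀ n k → suc k * (n C suc k) + k * (n C k) ≡ n * (n C k)
absorption-sum zero    zero    = refl
absorption-sum zero    (suc k) = cong₂ _+_ (*-zeroʳ (suc (suc k))) (*-zeroʳ (suc k))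
absorption-sum (suc n) zero    = trans (+-identityʳ _) (trans (*-identityˡ _) (trans (nC1≡n (suc n)) (sym (*-identityʳ _))))
absorption-sum (suc n) (suc k) = begin
  suc (suc k) * (suc n C suc (suc k)) + suc k * (suc n C suc k)
    ≡⟨ cong₂ (λ a b → suc (suc k) * a + suc k * b) (pascal n (suc k)) (pascal n k) ⟨
  suc (suc k) * (v + w) + suc k * (u + v)
    ≡⟨ regroup k u v w ⟩
  (suc (suc k) * w + suc k * v) + (suc k * v + k * u) + (u + v)
    ≡⟨ cong₂ (λ a b → a + b + (u + v)) (absorption-sum n (suc k)) (absorption-sum n k) ⟩
  n * v + n * u + (u + v)
    ≡⟨ collect n u v ⟩
  suc n * (u + v)
    ≡⟨ cong (suc n *_) (pascal n k) ⟩
  suc n * (suc n C suc k) ∎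
  where
  open ≡-Reasoning
  u = n C k
  v = n C suc k
  w = n C suc (suc k)
  regroup : ∀ k u v w → suc (suc k) * (v + w) + suc k * (u + v) ≡ (suc (suc k) * w + suc k * v) + (suc k * v + k * u) + (u + v)
  regroup = solve-∀
  collect : ∀ n u v → n * v + n * u + (u + v) ≡ suc n * (u + v)
  collect = solve-∀

-- Also for k > n, where both sides vanish despite the truncated subtraction.
absorption : ∀ n k → (n ∸ k) * (n C k) ≡ suc k * (n C suc k)
absorption n k with k ≤? n
... | yes k≤n = +-cancelʳ-≡ (k * (n C k)) _ _ (begin
  (n ∸ k) * (n C k) + k * (n C k)   ≡⟨ *-distribʳ-+ (n C k) (n ∸ k) k ⟨
  (n ∸ k + k) * (n C k)           ≡⟨ cong (_* (n C k)) (m∸n+n≡m k≤n) ⟩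
  n * (n C k)                     ≡⟨ absorption-sum n k ⟨
  suc k * (n C suc k) + k * (n C k) ∎)
  where open ≡-Reasoning
... | no k≰n = trans (cong ((n ∸ k) *_) (k>n⇒nCk≡0 n<k)) (trans (*-zeroʳ (n ∸ k))
    (sym (trans (cong (suc k *_) (k>n⇒nCk≡0 (m<n⇒m<1+n n<k))) (*-zeroʳ (suc k)))))
  where n<k = ≰⇒> k≰n

oddShape evenShape : ℕ → Table
oddShape  n zero    d = (n C d) * (n C d)
oddShape  n (suc _) d = (n C d) * (n C suc d)
evenShape n zero    d = (n C d) * (suc n C d)
evenShape n (suc _) d = (n C d) * (suc n C suc d)

cancel-added : ∀ {a b x y} → a + x ≡ b + y → x ≡ y → a ≡ b
cancel-added {a} {b} {x} a+x≡b+x refl = +-cancelʳ-≡ x a b a+x≡b+x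

-- For d = suc k the difference of the two sides is a combination of instances of absorption
-- and absorption-sum at k and suc k; adding these instances to both sides (cancel-added) leaves a
-- polynomial identity.
insertMax-oddShape : ∀ n j d → insertMax (suc n) n true (oddShape n) j d ≡ suc n * evenShape n j d
insertMax-oddShape n zero zero = lemma n
  where lemma : ∀ n → (suc n + 0 + 0) * (1 * 1) + 0 ≡ suc n * (1 * 1)
        lemma = solve-∀
insertMax-oddShape n (suc zero) zero = begin
  1 * (1 * 1 + 0) + ((suc n + 1 + 0) * (1 * (n C 1)) + 0)  ≡⟨ cong (λ c → 1 * (1 * 1 + 0) + ((suc n + 1 + 0) * (1 * c) + 0)) (nC1≡n n) ⟩
  1 * (1 * 1 + 0) + ((suc n + 1 + 0) * (1 * n) + 0)        ≡⟨ lemma n ⟩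
  suc n * (1 * suc n)                                      ≡⟨ cong (λ c → suc n * (1 * c)) (nC1≡n (suc n)) ⟨
  suc n * (1 * (suc n C 1))                                ∎
  where
  open ≡-Reasoning
  lemma : ∀ n → 1 * (1 * 1 + 0) + ((suc n + 1 + 0) * (1 * n) + 0) ≡ suc n * (1 * suc n)
  lemma = solve-∀
insertMax-oddShape n zero (suc k) = begin
  (suc n + 0 + suc k) * (v * v) + (n ∸ k) * (u * u)
    ≡⟨ cancel-added (lemma n k (n ∸ k) u v) (cong₂ _+_ (cong (u *_) (sym (absorption n k))) (cong (v *_) (sym (absorption-sum n k)))) ⟩
  suc n * (v * (u + v))
    ≡⟨ cong (λ c → suc n * (v * c)) (pascal n k) ⟩
  suc n * (v * (suc n C suc k)) ∎
  where
  open ≡-Reasoning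
  u = n C k
  v = n C suc k
  lemma : ∀ n k t u v →
    ((suc n + 0 + suc k) * (v * v) + t * (u * u)) + (u * (suc k * v) + v * (n * u))
      ≡ suc n * (v * (u + v)) + (u * (t * u) + v * (suc k * v + k * u))
  lemma = solve-∀
insertMax-oddShape n (suc zero) (suc k) = begin
  1 * (v * v + u * v) + ((suc n + 1 + suc k) * (v * w) + (n ∸ 1 ∸ k) * (u * v))
    ≡⟨ cong (λ t → 1 * (v * v + u * v) + ((suc n + 1 + suc k) * (v * w) + t * (u * v))) (∸-+-assoc n 1 k) ⟩
  1 * (v * v + u * v) + ((suc n + 1 + suc k) * (v * w) + (n ∸ suc k) * (u * v))
    ≡⟨ cancel-added (lemma n k (n ∸ suc k) u v w)
         (cong₂ _+_ (cong₂ _+_ (cong (u *_) (sym (absorption n (suc k)))) (cong ((u + v) *_) (sym (absorption-sum n (suc k)))))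
                    (cong (v *_) (absorption-sum n k))) ⟩
  suc n * (v * (v + w))
    ≡⟨ cong (λ c → suc n * (v * c)) (pascal n (suc k)) ⟩
  suc n * (v * (suc n C suc (suc k))) ∎
  where
  open ≡-Reasoning
  u = n C k
  v = n C suc k
  w = n C suc (suc k)
  lemma : ∀ n k t u v w →
    (1 * (v * v + u * v) + ((suc n + 1 + suc k) * (v * w) + t * (u * v)))
      + (u * (suc (suc k) * w) + (u + v) * (n * v) + v * (suc k * v + k * u))
      ≡ suc n * (v * (v + w))
        + (u * (t * v) + (u + v) * (suc (suc k) * w + suc k * v) + v * (n * u))
  lemma = solve-∀

insertMax-evenShape : ∀ n j d → insertMax (suc n) (suc n) false (evenShape n) j d ≡ suc (suc n) * oddShape (suc n) j d
insertMax-evenShape n zero zero = lemma n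
  where lemma : ∀ n → 1 * (1 * 1 + 0) + ((suc n + 0 + 0) * (1 * 1) + 0) ≡ suc (suc n) * (1 * 1)
        lemma = solve-∀
insertMax-evenShape n (suc zero) zero = lemma n (suc n C 1)
  where lemma : ∀ n c → (suc n + 1 + 0) * (1 * c) + 0 ≡ suc (suc n) * (1 * c)
        lemma = solve-∀
insertMax-evenShape n zero (suc k) = begin
  1 * (v * c + u * c) + ((suc n + 0 + suc k) * (v * c) + (suc n ∸ k) * (u * c₀))
    ≡⟨ cong (λ c → 1 * (v * c + u * c) + ((suc n + 0 + suc k) * (v * c) + (suc n ∸ k) * (u * c₀))) (pascal n k) ⟨
  1 * (v * (u + v) + u * (u + v)) + ((suc n + 0 + suc k) * (v * (u + v)) + (suc n ∸ k) * (u * c₀))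
    ≡⟨ cancel-added (lemma n k (suc n ∸ k) c₀ u v)
         (cong₂ _+_ (cong (u *_) (trans (cong (suc k *_) (pascal n k)) (sym (absorption (suc n) k))))
                    (cong ((u + v) *_) (sym (absorption-sum n k)))) ⟩
  suc (suc n) * ((u + v) * (u + v))
    ≡⟨ cong (λ c → suc (suc n) * (c * c)) (pascal n k) ⟩
  suc (suc n) * (c * c) ∎
  where
  open ≡-Reasoning
  u = n C k
  v = n C suc k
  c = suc n C suc k
  c₀ = suc n C k
  lemma : ∀ n k t c₀ u v →
    (1 * (v * (u + v) + u * (u + v)) + ((suc n + 0 + suc k) * (v * (u + v)) + t * (u * c₀)))
      + (u * (suc k * (u + v)) + (u + v) * (n * u))
      ≡ suc (suc n) * ((u + v) * (u + v)) + (u * (t * c₀) + (u + v) * (suc k * v + k * u))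
  lemma = solve-∀
insertMax-evenShape n (suc zero) (suc k) = begin
  (suc n + 1 + suc k) * (v * c′) + (n ∸ k) * (u * c)
    ≡⟨ cong₂ (λ c c′ → (suc n + 1 + suc k) * (v * c′) + (n ∸ k) * (u * c)) (pascal n k) (pascal n (suc k)) ⟨
  (suc n + 1 + suc k) * (v * (v + w)) + (n ∸ k) * (u * (u + v))
    ≡⟨ cancel-added (lemma n k (n ∸ k) u v w)
         (cong₂ _+_ (cong₂ _+_ (cong ((u + v) *_) (sym (absorption n k))) (cong ((v + v + w) *_) (sym (absorption-sum n k))))
                    (cong (u *_) (absorption-sum n (suc k)))) ⟩
  suc (suc n) * ((u + v) * (v + w))
    ≡⟨ cong₂ (λ c c′ → suc (suc n) * (c * c′)) (pascal n k) (pascal n (suc k)) ⟩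
  suc (suc n) * (c * c′) ∎
  where
  open ≡-Reasoning
  u = n C k
  v = n C suc k
  w = n C suc (suc k)
  c = suc n C suc k
  c′ = suc n C suc (suc k)
  lemma : ∀ n k t u v w →
    ((suc n + 1 + suc k) * (v * (v + w)) + t * (u * (u + v)))
      + ((u + v) * (suc k * v) + (v + v + w) * (n * u) + u * (suc (suc k) * w + suc k * v))
      ≡ suc (suc n) * ((u + v) * (v + w))
        + ((u + v) * (t * u) + (v + v + w) * (suc k * v + k * u) + u * (n * v))
  lemma = solve-∀

isEven-double : ∀ n → isEven (n + n) ≡ true
isEven-double zero    = refl
isEven-double (suc n) = trans (cong (λ m → isEven (suc m)) (+-suc n n)) (isEven-double n)

isEven-suc-double : ∀ n → isEven (suc (n + n)) ≡ false
isEven-suc-double zero    = refl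
isEven-suc-double (suc n) = trans (cong (λ m → isEven (suc (suc m))) (+-suc n n)) (isEven-suc-double n)

evensUpTo-double : ∀ n → evensUpTo (n + n) ≡ n
evensUpTo-double zero    = refl
evensUpTo-double (suc n) rewrite +-suc n n | isEven-double n | isEven-suc-double n = cong suc (evensUpTo-double n)

oddsUpTo-double : ∀ n → oddsUpTo (n + n) ≡ n
oddsUpTo-double zero    = refl
oddsUpTo-double (suc n) rewrite +-suc n n | isEven-double n | isEven-suc-double n = cong suc (oddsUpTo-double n)

P-even-recurrence : ∀ n j d → P j d (suc (suc (n + n))) ≡ insertMax (suc n) n true (λ j d → P j d (suc (n + n))) j d
P-even-recurrence n j d rewrite P-recurrence (n + n) j d | isEven-suc-double n | isEven-double n
                              | evensUpTo-double n | oddsUpTo-double n = refl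

P-odd-recurrence : ∀ n j d →
  P j d (suc (suc (suc (n + n)))) ≡ insertMax (suc n) (suc n) false (λ j d → P j d (suc (suc (n + n)))) j d
P-odd-recurrence n j d rewrite P-recurrence (suc (n + n)) j d | isEven-suc-double n | isEven-double n
                             | evensUpTo-double n | oddsUpTo-double n = refl

P-odd  : ∀ n j d → P j d (suc (n + n)) ≡ n ! * suc n ! * oddShape n j d
P-even : ∀ n j d → P j d (suc (suc (n + n))) ≡ n ! * suc n ! * suc n * evenShape n j d

P-odd zero zero       zero    = refl
P-odd zero zero       (suc d) = refl
P-odd zero (suc zero) zero    = refl
P-odd zero (suc zero) (suc d) = refl
P-odd (suc n) j d = begin
  P j d (suc (suc n + suc n))
    ≡⟨ cong (λ m → P j d (suc (suc m))) (+-suc n n) ⟩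
  P j d (suc (suc (suc (n + n))))
    ≡⟨ P-odd-recurrence n j d ⟩
  insertMax (suc n) (suc n) false (λ j d → P j d (suc (suc (n + n)))) j d
    ≡⟨ insertMax-cong (suc n) (suc n) false (P-even n) j d ⟩
  insertMax (suc n) (suc n) false (λ j d → K * evenShape n j d) j d
    ≡⟨ insertMax-* (suc n) (suc n) false K (evenShape n) j d ⟩
  K * insertMax (suc n) (suc n) false (evenShape n) j d
    ≡⟨ cong (K *_) (insertMax-evenShape n j d) ⟩
  K * (suc (suc n) * oddShape (suc n) j d)
    ≡⟨ *-assoc K (suc (suc n)) _ ⟨
  K * suc (suc n) * oddShape (suc n) j d
    ≡⟨ cong (_* oddShape (suc n) j d) (factorials n (n !)) ⟩
  suc n ! * suc (suc n) ! * oddShape (suc n) j d ∎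
  where
  open ≡-Reasoning
  K = n ! * suc n ! * suc n
  factorials : ∀ n f → f * (suc n * f) * suc n * suc (suc n) ≡ suc n * f * (suc (suc n) * (suc n * f))
  factorials = solve-∀
P-even n j d = begin
  P j d (suc (suc (n + n)))
    ≡⟨ P-even-recurrence n j d ⟩
  insertMax (suc n) n true (λ j d → P j d (suc (n + n))) j d
    ≡⟨ insertMax-cong (suc n) n true (P-odd n) j d ⟩
  insertMax (suc n) n true (λ j d → K * oddShape n j d) j d
    ≡⟨ insertMax-* (suc n) n true K (oddShape n) j d ⟩
  K * insertMax (suc n) n true (oddShape n) j d
    ≡⟨ cong (K *_) (insertMax-oddShape n j d) ⟩
  K * (suc n * evenShape n j d)
    ≡⟨ *-assoc K (suc n) _ ⟨
  K * suc n * evenShape n j d ∎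
  where
  open ≡-Reasoning
  K = n ! * suc n !

binomial-symmetric : ∀ {n} k i → k + i ≡ n → n C k ≡ n C i
binomial-symmetric k i refl = trans (nCk≡nC[n∸k] (m≤m+n k i)) (cong ((k + i) C_) (m+n∸m≡n k i))

P-odd₀-symmetric : ∀ {n k i} → k + i ≡ n → P zero k (suc (n + n)) ≡ P zero i (suc (n + n))
P-odd₀-symmetric {n} {k} {i} k+i≡n = begin
  P zero k (suc (n + n))           ≡⟨ P-odd n zero k ⟩
  K * ((n C k) * (n C k))          ≡⟨ cong (λ c → K * (c * c)) (binomial-symmetric k i k+i≡n) ⟩
  K * ((n C i) * (n C i))          ≡⟨ P-odd n zero i ⟨
  P zero i (suc (n + n))           ∎
  where
  open ≡-Reasoning
  K = n ! * suc n !

P-odd₁-symmetric : ∀ {n k i} → k + suc i ≡ n → P (suc zero) k (suc (n + n)) ≡ P (suc zero) i (suc (n + n))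
P-odd₁-symmetric {n} {k} {i} k+1+i≡n = begin
  P (suc zero) k (suc (n + n))     ≡⟨ P-odd n (suc zero) k ⟩
  K * ((n C k) * (n C suc k))      ≡⟨ cong₂ (λ a b → K * (a * b)) (binomial-symmetric k (suc i) k+1+i≡n)
                                                                (binomial-symmetric (suc k) i (trans (sym (+-suc k i)) k+1+i≡n)) ⟩
  K * ((n C suc i) * (n C i))      ≡⟨ cong (K *_) (*-comm (n C suc i) (n C i)) ⟩
  K * ((n C i) * (n C suc i))      ≡⟨ P-odd n (suc zero) i ⟨
  P (suc zero) i (suc (n + n))     ∎
  where
  open ≡-Reasoning
  K = n ! * suc n !

P-odd₁-vanishes : ∀ {n k} → n ≤ k → P (suc zero) k (suc (n + n)) ≡ 0
P-odd₁-vanishes {n} {k} n≤k = begin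
  P (suc zero) k (suc (n + n))     ≡⟨ P-odd n (suc zero) k ⟩
  K * ((n C k) * (n C suc k))      ≡⟨ cong (λ c → K * ((n C k) * c)) (k>n⇒nCk≡0 (s≤s n≤k)) ⟩
  K * ((n C k) * 0)                ≡⟨ cong (K *_) (*-zeroʳ (n C k)) ⟩
  K * 0                            ≡⟨ *-zeroʳ K ⟩
  0                                ∎
  where
  open ≡-Reasoning
  K = n ! * suc n !

twice-plus-one : ∀ n → 2 * n + 1 ≡ suc (n + n)
twice-plus-one = solve-∀

theorem4p4 : (n k : ℕ) → 1 ≤ n → k ≤ n →
    (Pℤ zero (+ k) (2 * n + 1) ≡ Pℤ zero ((+ n) -ℤ (+ k)) (2 * n + 1))
    × (Pℤ (suc zero) (+ k) (2 * n + 1) ≡ Pℤ (suc zero) ((+ n) -ℤ (+ k) -ℤ (+ 1)) (2 * n + 1))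
theorem4p4 n k _ k≤n rewrite twice-plus-one n | [+m]-[+n]≡m⊖n n k | ⊖-≥ k≤n =
  P-odd₀-symmetric (m+[n∸m]≡n k≤n) , P-odd₁-reflected (n ∸ k) (m+[n∸m]≡n k≤n)
  where
  -- For i = 0 the reflected index is -1, where Pℤ is 0.
  P-odd₁-reflected : ∀ i → k + i ≡ n → P (suc zero) k (suc (n + n)) ≡ Pℤ (suc zero) (+ i -ℤ + 1) (suc (n + n))
  P-odd₁-reflected zero    k+0≡n = P-odd₁-vanishes (≤-reflexive (trans (sym k+0≡n) (+-identityʳ k)))
  P-odd₁-reflected (suc i) k+i≡n = P-odd₁-symmetric k+i≡n
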